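{- Let $G$ be a graph with $V(G)=\{1,\dots,n\}$ and let $S,T$ be disjoint subsets of $V(G)$ such that \[\rho_{G[S\cup T]}(S)=\min_{S\subseteq X\subseteq V(G)-T}\rho_G(X)=k.\] Let $C=V(G)-(S\cup T)$. Then for every $Z\subseteq V(G)$ with $S\subseteq Z\subseteq V(G)-T$ and $\rho_G(Z)=k$: (i) for all $x,y\in\langle I_Z\cup A_Z\rangle$, $x-y\in\langle I_C\rangle$ iff $x-y\in\langle I_{C\cap Z}\rangle$; (ii) for all $x,y\in\langle I_{V(G)-Z}\cup A_{V(G)-Z}\rangle$, $x-y\in\langle I_C\rangle$ iff $x-y\in\langle I_{C-Z}\rangle$; (iii) for all $x,y\in\partial_Z$, $x-y\in\langle I_C\rangle$ iff $x=y$; (iv) if $Z'\subseteq V(G)$ also satisfies $S\subseteq Z'\subseteq V(G)-T$ and $\rho_G(Z')=k$, then for each $x\in\partial_{Z'}$ there is a unique $y\in\partial_Z$ with $x-y\in\langle I_C\rangle$, and moreover $x-y\in\langle I_{C\cap(Z\triangle Z')}\rangle$.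
   Context: Graphs are finite and simple; $G[S\cup T]$ is the induced subgraph. $\rho_G(X)$ is the rank over the binary field $\mathbb F_2$ of the $X\times(V(G)-X)$ adjacency submatrix. Let $e_1,\dots,e_n$ be the standard basis of $\mathbb F_2^n$ and $v_i=\sum_{j\in N_G(i)}e_j$. For $X\subseteq V(G)$, $I_X=\{e_i:i\in X\}$, $A_X=\{v_i:i\in X\}$, and $\partial_X=\langle I_X\cup A_X\rangle\cap\langle I_{V(G)-X}\cup A_{V(G)-X}\rangle$, where $\langle\cdot\rangle$ is linear span. $Z\triangle Z'=(Z-Z')\cup(Z'-Z)$. -}

module Defs where

open import Data.Nat using (ℕ; _≤_)
open import Data.Bool using (Bool; true; false; _∧_; _xor_; not; if_then_else_)
open import Data.Fin using (Fin)
open import Data.Fin.Subset using (Subset; _∈_; _⊆_; _∩_; _∪_; _─_; ∁; ⊥; ∣_∣)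
open import Data.Vec using (Vec; lookup; tabulate; zipWith; replicate; foldr; allFin; map)
open import Data.Product using (Σ; ∃; _×_)
open import Relation.Binary.PropositionalEquality using (_≡_)

-- A finite simple graph on vertex set Fin n (= {1,…,n}), adjacency over 𝔽₂ = Bool.
record Graph (n : ℕ) : Set where
  field
    adj   : Fin n → Fin n → Bool
    sym   : ∀ i j → adj i j ≡ adj j i
    loopless : ∀ i → adj i i ≡ false
open Graph public

𝔽₂^ : ℕ → Set
𝔽₂^ n = Vec Bool n

0ᵥ : ∀ {n} → 𝔽₂^ n
0ᵥ = replicate _ false

infixl 6 _+ᵥ_ _-ᵥ_
_+ᵥ_ : ∀ {n} → 𝔽₂^ n → 𝔽₂^ n → 𝔽₂^ n
_+ᵥ_ = zipWith _xor_

_-ᵥ_ : ∀ {n} → 𝔽₂^ n → 𝔽₂^ n → 𝔽₂^ n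
_-ᵥ_ = zipWith _xor_   -- over 𝔽₂, -1 = 1

sumOver : ∀ {n m} → Subset n → (Fin n → 𝔽₂^ m) → 𝔽₂^ m
sumOver {n} D f = foldr _ (λ i acc → if lookup D i then f i +ᵥ acc else acc) 0ᵥ (allFin n)

e : ∀ {n} → Fin n → 𝔽₂^ n
e i = tabulate (λ j → lookup (Data.Fin.Subset.⁅_⁆ i) j)

vG : ∀ {n} → Graph n → Fin n → 𝔽₂^ n
vG G i = sumOver (tabulate (adj G i)) e

Span-I : ∀ {n} → Subset n → 𝔽₂^ n → Set
Span-I X x = ∃ λ D → D ⊆ X × x ≡ sumOver D e

Span-IA : ∀ {n} → Graph n → Subset n → 𝔽₂^ n → Set
Span-IA G X x = Σ (Subset _) λ D → Σ (Subset _) λ D' →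
  D ⊆ X × D' ⊆ X × x ≡ sumOver D e +ᵥ sumOver D' (vG G)

∂ : ∀ {n} → Graph n → Subset n → 𝔽₂^ n → Set
∂ G X x = Span-IA G X x × Span-IA G (∁ X) x

-- Rank over 𝔽₂ of the R × C submatrix of the adjacency matrix:
-- row i is the vector (adj i j)_{j ∈ C} (entries outside C set to 0),
-- and the rank is the maximum number of linearly independent rows.
row : ∀ {n} → Graph n → Subset n → Fin n → 𝔽₂^ n
row G C i = tabulate (λ j → adj G i j ∧ lookup C j)

RowsIndep : ∀ {n} → Graph n → Subset n → Subset n → Set
RowsIndep G C Y = ∀ D → D ⊆ Y → sumOver D (row G C) ≡ 0ᵥ → D ≡ ⊥

RankIs : ∀ {n} → Graph n → (R C : Subset n) → ℕ → Set
RankIs G R C k =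
  (∃ λ Y → Y ⊆ R × RowsIndep G C Y × ∣ Y ∣ ≡ k) ×
  (∀ Y → Y ⊆ R → RowsIndep G C Y → ∣ Y ∣ ≤ k)

ρ≡ : ∀ {n} → Graph n → Subset n → ℕ → Set
ρ≡ G X k = RankIs G X (∁ X) k

-- ρ_{G[S ∪ T]}(S) = k : rank of the S × ((S ∪ T) - S) submatrix of the
-- adjacency matrix of G[S ∪ T] (which is the corresponding submatrix of G's).
ρInduced≡ : ∀ {n} → Graph n → (S T : Subset n) → ℕ → Set
ρInduced≡ G S T k = RankIs G S ((S ∪ T) ─ S) k

_△_ : ∀ {n} → Subset n → Subset n → Subset n
Z △ Z' = (Z ─ Z') ∪ (Z' ─ Z)

{-# OPTIONS --safe #-}
-- By ρ_{G[S∪T]}(S) = k there are k rows Y ⊆ S of the adjacency matrix that are independent on the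
-- columns T. For S ⊆ Z ⊆ V − T they stay independent on V − Z, and as ρ_G(Z) ≤ k they form a row
-- basis of the Z × (V − Z) matrix. Hence a vector of ⟨I_Z ∪ A_Z⟩ is, off Z, some Σ_{y ∈ r} v_y with
-- r ⊆ Y, and so determined by its values on T; and, the adjacency matrix being symmetric, a vector of
-- ⟨I_{V−Z} ∪ A_{V−Z}⟩ is determined on Z by its values on Y ⊆ S. A difference supported in C
-- vanishes on S ∪ T, which gives (i)–(iii). For (iv), independence of Y on T means that any values
-- on Y are attained by some Σ_{t ∈ g} v_t with g ⊆ T; taking this match of x ∈ ∂_{Z′} inside Z and
-- the reduction of x off Z′ outside Z glues to a y ∈ ∂_Z with x − y supported in Z △ Z′.
module Submission where

open import Defs hiding (sym)
open import Algebra.Bundles using (CommutativeRing)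
open import Data.Bool using (Bool; true; false; _∧_; _∨_; _xor_; not; if_then_else_)
open import Data.Bool.Properties
  using ( xor-∧-commutativeRing; xor-same; xor-identityʳ; xor-comm; xor-assoc; xor-annihilates-not
        ; ∧-zeroʳ; ∧-identityʳ; ∧-comm; ∧-assoc; ∧-distribʳ-xor; ∨-zeroʳ; ∨-identityʳ
        ; not-involutive; ¬-not )
  renaming (_≟_ to _≟ᵇ_)
open import Data.Fin using (Fin; zero; suc)
open import Data.Fin.Properties using (any?)
open import Data.Fin.Subset
  using (Subset; outside; _∈_; _∉_; _⊆_; _∩_; _∪_; _─_; ∁; ⊥; ⁅_⁆; ∣_∣; Nonempty)
open import Data.Fin.Subset.Properties
  using ( x∈⁅x⁆; x∈⁅y⁆⇒x≡y; anySubset?; _⊆?_; nonempty?; Empty-unique; ⊆-trans; p⊂q⇒∣p∣<∣q∣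
        ; p⊆p∪q; q⊆p∪q; x∈p∪q⁺; x∈p∪q⁻; p∩q⊆p; x∈p∩q⁺; p─q⊆p; x∈p∧x∉q⇒x∈p─q
        ; x∉p⇒x∈∁p; x∈p⇒x∉∁p; x∈∁p⇒x∉p; p⊆q⇒∁p⊇∁q )
open import Data.List using (List; []; _∷_; allFin)
open import Data.List.Membership.Propositional using () renaming (_∈_ to _∈ˡ_)
open import Data.List.Membership.Propositional.Properties using (∈-allFin)
open import Data.List.Relation.Unary.Any using (here; there)
open import Data.Nat using (ℕ; suc; _≤_; _<_)
open import Data.Nat.Properties using (<⇒≱)
open import Data.Product using (Σ; ∃; _×_; _,_; proj₁; proj₂)
open import Data.Sum using (_⊎_; inj₁; inj₂; [_,_]′)
open import Data.Vec using (lookup; tabulate; foldr; _∷_; here; there)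
open import Data.Vec.Functional using (Vector)
open import Data.Vec.Properties
  using (≡-dec; lookup-map; lookup-zipWith; lookup-replicate; lookup∘tabulate; []=⇒lookup; lookup⇒[]=)
open import Data.Vec.Relation.Binary.Pointwise.Extensional using (ext; Pointwise-≡⇒≡)
open import Function using (_∘_; const; id)
open import Function.Bundles using (_⇔_; mk⇔)
open import Relation.Nullary using (yes; no; contradiction)
open import Relation.Nullary.Decidable using (_×-dec_)
open import Relation.Binary.PropositionalEquality
open import Algebra.Properties.Semiring.Sum (CommutativeRing.semiring xor-∧-commutativeRing)
  using (sum-syntax; sum-cong-≗; sum-replicate-zero; ∑-distrib-+; ∑-comm; *-distribˡ-sum; *-distribʳ-sum)

private variable n : ℕ

xor≡false⇒≡ : ∀ {a b} → a xor b ≡ false → a ≡ b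
xor≡false⇒≡ {true}  {true}  _ = refl
xor≡false⇒≡ {false} {false} _ = refl

xor≡true⇒ : ∀ {a b} → a xor b ≡ true → a ≡ true ⊎ b ≡ true
xor≡true⇒ {true}  _ = inj₁ refl
xor≡true⇒ {false} p = inj₂ p

∨≡true⇒ : ∀ {a b} → a ∨ b ≡ true → a ≡ true ⊎ b ≡ true
∨≡true⇒ {true}  _ = inj₁ refl
∨≡true⇒ {false} p = inj₂ p

∧≡true⇒ : ∀ {a b} → a ∧ b ≡ true → a ≡ true × b ≡ true
∧≡true⇒ {true} {true} _ = refl , refl

∧≡false : ∀ {a b} → (b ≡ true → a ≡ false) → a ∧ b ≡ false
∧≡false {a} {true}  a≡false = trans (∧-identityʳ a) (a≡false refl)
∧≡false {a} {false} _       = ∧-zeroʳ a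

∧-cong-if : ∀ {a b c} → (a ≡ true → b ≡ c) → a ∧ b ≡ a ∧ c
∧-cong-if {true}  b≡c = b≡c refl
∧-cong-if {false} _   = refl

∧-swapˡ : ∀ a b c → a ∧ (b ∧ c) ≡ b ∧ (a ∧ c)
∧-swapˡ a b c = trans (sym (∧-assoc a b c)) (trans (cong (_∧ c) (∧-comm a b)) (∧-assoc b a c))

∧-swapʳ : ∀ a b c → (a ∧ b) ∧ c ≡ (a ∧ c) ∧ b
∧-swapʳ a b c = trans (∧-assoc a b c) (trans (cong (a ∧_) (∧-comm b c)) (sym (∧-assoc a c b)))

xor-cancelˡ : ∀ a b → a xor (b xor a) ≡ b
xor-cancelˡ a b = trans (cong (a xor_) (xor-comm b a)) (trans (sym (xor-assoc a a b)) (cong (_xor b) (xor-same a)))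

xor-cancelʳ : ∀ a b → (a xor b) xor b ≡ a
xor-cancelʳ a b = trans (xor-assoc a b b) (trans (cong (a xor_) (xor-same b)) (xor-identityʳ a))

xor-cancel-middle : ∀ a b c → (a xor b) xor (a xor c) ≡ b xor c
xor-cancel-middle false b c = refl
xor-cancel-middle true  b c = xor-annihilates-not b c

∑-zero : ∀ (f : Vector Bool n) → (∀ i → f i ≡ false) → ∑[ i < n ] f i ≡ false
∑-zero {n} f f≡0 = trans (sum-cong-≗ f≡0) (sum-replicate-zero n)

δ : Fin n → Fin n → Bool
δ i j = lookup ⁅ i ⁆ j

lookup-⊥ : ∀ (j : Fin n) → lookup ⊥ j ≡ false
lookup-⊥ j = lookup-replicate j false

δ-diag : ∀ (i : Fin n) → δ i i ≡ true
δ-diag i = []=⇒lookup (x∈⁅x⁆ i)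

δ⇒≡ : ∀ {i j : Fin n} → δ i j ≡ true → j ≡ i
δ⇒≡ {i = i} {j} p = x∈⁅y⁆⇒x≡y i (lookup⇒[]= j ⁅ i ⁆ p)

δ-sym : ∀ (i j : Fin n) → δ i j ≡ δ j i
δ-sym zero    zero    = refl
δ-sym zero    (suc j) = lookup-⊥ j
δ-sym (suc i) zero    = sym (lookup-⊥ i)
δ-sym (suc i) (suc j) = δ-sym i j

∑-δ : ∀ (f : Vector Bool n) j → ∑[ i < n ] (f i ∧ δ i j) ≡ f j
∑-δ {suc n} f zero =
  trans (cong₂ _xor_ (∧-identityʳ (f zero)) (∑-zero _ (∧-zeroʳ ∘ f ∘ suc))) (xor-identityʳ (f zero))
∑-δ {suc n} f (suc j) =
  trans (cong (_xor ∑[ i < n ] (f (suc i) ∧ δ i j)) (trans (cong (f zero ∧_) (lookup-⊥ j)) (∧-zeroʳ (f zero))))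
        (∑-δ (f ∘ suc) j)

vec-ext : ∀ {x y : 𝔽₂^ n} → (∀ j → lookup x j ≡ lookup y j) → x ≡ y
vec-ext = Pointwise-≡⇒≡ ∘ ext

lookup-∁ : ∀ (p : Subset n) {j b} → lookup p j ≡ b → lookup (∁ p) j ≡ not b
lookup-∁ p {j} p≡b = trans (lookup-map j not p) (cong not p≡b)

lookup-∁⁻ : ∀ (p : Subset n) {j b} → lookup (∁ p) j ≡ b → lookup p j ≡ not b
lookup-∁⁻ p {j} ∁p≡b =
  trans (sym (not-involutive (lookup p j))) (cong not (trans (sym (lookup-map j not p)) ∁p≡b))

infix 4 _⊑_ _≗_on_

_⊑_ : Vector Bool n → Vector Bool n → Set
u ⊑ X = ∀ i → u i ≡ true → X i ≡ true

_≗_on_ : (u v C : Vector Bool n) → Set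
u ≗ v on C = ∀ j → C j ≡ true → u j ≡ v j

⊑-false : ∀ {u X : Vector Bool n} → u ⊑ X → ∀ i → X i ≡ false → u i ≡ false
⊑-false {u = u} u⊑X i Xi with u i in ui
... | false = refl
... | true  = trans (sym (u⊑X i ui)) Xi

⊑-intro : ∀ {u X : Vector Bool n} → (∀ i → X i ≡ false → u i ≡ false) → u ⊑ X
⊑-intro {X = X} u≡0 i ui with X i in Xi
... | true  = refl
... | false = sym (trans (sym ui) (u≡0 i Xi))

⊑-trans : ∀ {u v w : Vector Bool n} → u ⊑ v → v ⊑ w → u ⊑ w
⊑-trans u⊑v v⊑w i = v⊑w i ∘ u⊑v i

δ⊑ : ∀ {X : Vector Bool n} {i} → X i ≡ true → δ i ⊑ X
δ⊑ {X = X} Xi j δij = subst (λ k → X k ≡ true) (sym (δ⇒≡ δij)) Xi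

⊑-xor : ∀ {u v X : Vector Bool n} → u ⊑ X → v ⊑ X → (λ i → u i xor v i) ⊑ X
⊑-xor u⊑X v⊑X i p with xor≡true⇒ p
... | inj₁ ui = u⊑X i ui
... | inj₂ vi = v⊑X i vi

⊑-∧ˡ : ∀ {u X : Vector Bool n} b → u ⊑ X → (λ i → b ∧ u i) ⊑ X
⊑-∧ˡ b u⊑X i p = u⊑X i (proj₂ (∧≡true⇒ {b} p))

⊑-∑ : ∀ {X : Vector Bool n} (w : Vector Bool n) {F : Fin n → Vector Bool n} → (∀ y → F y ⊑ X) →
  (λ i → ∑[ y < n ] (w y ∧ F y i)) ⊑ X
⊑-∑ w F⊑X = ⊑-intro (λ i Xi → ∑-zero _ (λ y → trans (cong (w y ∧_) (⊑-false (F⊑X y) i Xi)) (∧-zeroʳ (w y))))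

-- Translating the definitions to coordinates

lookup-foldr-tabulate : ∀ {m k} (D : Subset n) (f : Fin n → 𝔽₂^ m) (g : Fin k → Fin n) j →
  lookup (foldr (λ _ → 𝔽₂^ m) (λ i acc → if lookup D i then f i +ᵥ acc else acc) 0ᵥ (tabulate g)) j
    ≡ ∑[ a < k ] (lookup D (g a) ∧ lookup (f (g a)) j)
lookup-foldr-tabulate {k = ℕ.zero} D f g j = lookup-replicate j false
lookup-foldr-tabulate {k = suc k}  D f g j with lookup D (g zero)
... | true  = trans (lookup-zipWith _xor_ j (f (g zero)) _)
                    (cong (lookup (f (g zero)) j xor_) (lookup-foldr-tabulate D f (g ∘ suc) j))
... | false = lookup-foldr-tabulate D f (g ∘ suc) j

lookup-sumOver : ∀ {m} (D : Subset n) (f : Fin n → 𝔽₂^ m) j →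
  lookup (sumOver D f) j ≡ ∑[ i < n ] (lookup D i ∧ lookup (f i) j)
lookup-sumOver D f = lookup-foldr-tabulate D f id

lookup-sumOver-e : ∀ (D : Subset n) j → lookup (sumOver D e) j ≡ lookup D j
lookup-sumOver-e D j = begin
  lookup (sumOver D e) j                    ≡⟨ lookup-sumOver D e j ⟩
  ∑[ i < _ ] (lookup D i ∧ lookup (e i) j)  ≡⟨ sum-cong-≗ (λ i → cong (lookup D i ∧_) (lookup∘tabulate (δ i) j)) ⟩
  ∑[ i < _ ] (lookup D i ∧ δ i j)           ≡⟨ ∑-δ (lookup D) j ⟩
  lookup D j                                ∎
  where open ≡-Reasoning

lookup-diff : ∀ (x y : 𝔽₂^ n) j → lookup (x -ᵥ y) j ≡ lookup x j xor lookup y j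
lookup-diff x y j = lookup-zipWith _xor_ j x y

⊆⇒⊑ : ∀ {X Y : Subset n} → X ⊆ Y → lookup X ⊑ lookup Y
⊆⇒⊑ X⊆Y i p = []=⇒lookup (X⊆Y (lookup⇒[]= i _ p))

⊑⇒⊆ : ∀ {X Y : Subset n} → lookup X ⊑ lookup Y → X ⊆ Y
⊑⇒⊆ X⊑Y {i} i∈X = lookup⇒[]= i _ (X⊑Y i ([]=⇒lookup i∈X))

lookup≡false⇒∉ : ∀ {p : Subset n} {j} → lookup p j ≡ false → j ∉ p
lookup≡false⇒∉ pj j∈p = contradiction (trans (sym ([]=⇒lookup j∈p)) pj) λ ()

≡⇒∉-ᵥ : ∀ {x y : 𝔽₂^ n} {j} → lookup x j ≡ lookup y j → j ∉ x -ᵥ y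
≡⇒∉-ᵥ {x = x} {y} {j} xj≡yj = lookup≡false⇒∉ {p = x -ᵥ y}
  (trans (lookup-diff x y j) (trans (cong (_xor lookup y j) xj≡yj) (xor-same (lookup y j))))

-- A vector of 𝔽₂ⁿ is read as the subset of its nonzero coordinates.
Span-I⇒⊆ : ∀ {X x : Subset n} → Span-I X x → x ⊆ X
Span-I⇒⊆ (D , D⊆X , refl) = ⊑⇒⊆ (λ j p → ⊆⇒⊑ D⊆X j (trans (sym (lookup-sumOver-e D j)) p))

⊆⇒Span-I : ∀ {X x : Subset n} → x ⊆ X → Span-I X x
⊆⇒Span-I {x = x} x⊆X = x , x⊆X , vec-ext (λ j → sym (lookup-sumOver-e x j))

-ᵥ-self : ∀ {x X : 𝔽₂^ n} → x -ᵥ x ⊆ X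
-ᵥ-self x∈ = contradiction x∈ (≡⇒∉-ᵥ refl)

-ᵥ-cancel : ∀ {X x y z : Subset n} → x -ᵥ y ⊆ X → x -ᵥ z ⊆ X → y -ᵥ z ⊆ X
-ᵥ-cancel {X = X} {x} {y} {z} x-y⊆X x-z⊆X =
  ⊑⇒⊆ {X = y -ᵥ z} (λ j p → ⊑-xor (⊆⇒⊑ x-y⊆X) (⊆⇒⊑ x-z⊆X) j (trans (lookups j) p))
  where
  lookups : ∀ j → lookup (x -ᵥ y) j xor lookup (x -ᵥ z) j ≡ lookup (y -ᵥ z) j
  lookups j = begin
    lookup (x -ᵥ y) j xor lookup (x -ᵥ z) j                      ≡⟨ cong₂ _xor_ (lookup-diff x y j) (lookup-diff x z j) ⟩
    (lookup x j xor lookup y j) xor (lookup x j xor lookup z j)  ≡⟨ xor-cancel-middle (lookup x j) _ _ ⟩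
    lookup y j xor lookup z j                                    ≡⟨ lookup-diff y z j ⟨
    lookup (y -ᵥ z) j                                            ∎
    where open ≡-Reasoning

-ᵥ-⊆∁⇒≡ : ∀ {X x y : Subset n} → x -ᵥ y ⊆ X → x -ᵥ y ⊆ ∁ X → x ≡ y
-ᵥ-⊆∁⇒≡ {X = X} {x} {y} ⊆X ⊆∁X = vec-ext (λ j → xor≡false⇒≡ (trans (sym (lookup-diff x y j))
  (¬-not (λ p → let j∈ = lookup⇒[]= j (x -ᵥ y) p in x∈p⇒x∉∁p (⊆X j∈) (⊆∁X j∈)))))

⊆∁-sym : ∀ {p q : Subset n} → p ⊆ ∁ q → q ⊆ ∁ p
⊆∁-sym p⊆∁q x∈q = x∉p⇒x∈∁p (λ x∈p → x∈p⇒x∉∁p x∈q (p⊆∁q x∈p))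

x∈p─q⇒x∉q : ∀ {p q : Subset n} {x} → x ∈ p ─ q → x ∉ q
x∈p─q⇒x∉q {p = _ ∷ _} {outside ∷ _} here       ()
x∈p─q⇒x∉q {p = _ ∷ _} {_ ∷ _}       (there x∈) (there x∈q) = x∈p─q⇒x∉q x∈ x∈q

p∪q─p⊆q : ∀ (p q : Subset n) → (p ∪ q) ─ p ⊆ q
p∪q─p⊆q p q x∈ with x∈p∪q⁻ p q (p─q⊆p (p ∪ q) p x∈)
... | inj₁ x∈p = contradiction x∈p (x∈p─q⇒x∉q x∈)
... | inj₂ x∈q = x∈q

-- Linear algebra of the adjacency matrix over 𝔽₂

∑v : Graph n → Vector Bool n → Vector Bool n
∑v {n} G d j = ∑[ i < n ] (d i ∧ adj G i j)

module _ (G : Graph n) where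

  ∑v-cong : ∀ {u v : Vector Bool n} → (∀ a → u a ≡ v a) → ∀ j → ∑v G u j ≡ ∑v G v j
  ∑v-cong u≗v j = sum-cong-≗ (λ a → cong (_∧ adj G a j) (u≗v a))

  ∑v-xor : ∀ (u v : Vector Bool n) j → ∑v G (λ a → u a xor v a) j ≡ ∑v G u j xor ∑v G v j
  ∑v-xor u v j = trans (sum-cong-≗ (λ a → ∧-distribʳ-xor (adj G a j) (u a) (v a)))
                       (∑-distrib-+ (λ a → u a ∧ adj G a j) (λ a → v a ∧ adj G a j))

  ∑v-scale : ∀ b (u : Vector Bool n) j → ∑v G (λ a → b ∧ u a) j ≡ b ∧ ∑v G u j
  ∑v-scale b u j = trans (sum-cong-≗ (λ a → ∧-assoc b (u a) (adj G a j)))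
                         (sym (*-distribˡ-sum b (λ a → u a ∧ adj G a j)))

  ∑v-zero : ∀ {u : Vector Bool n} → (∀ a → u a ≡ false) → ∀ j → ∑v G u j ≡ false
  ∑v-zero u≡0 j = ∑-zero _ (λ a → cong (_∧ adj G a j) (u≡0 a))

  ∑v-δ : ∀ (i j : Fin n) → ∑v G (δ i) j ≡ adj G i j
  ∑v-δ i j = trans (sum-cong-≗ (λ a → trans (cong (_∧ adj G a j) (δ-sym i a)) (∧-comm (δ a i) (adj G a j))))
                   (∑-δ (λ a → adj G a j) i)

  ∑v-∑ : ∀ (w : Vector Bool n) (F : Fin n → Vector Bool n) j →
    ∑v G (λ m → ∑[ y < n ] (w y ∧ F y m)) j ≡ ∑[ y < n ] (w y ∧ ∑v G (F y) j)
  ∑v-∑ w F j = begin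
    ∑[ m < n ] (∑[ y < n ] (w y ∧ F y m) ∧ adj G m j)
      ≡⟨ sum-cong-≗ (λ m → *-distribʳ-sum (adj G m j) (λ y → w y ∧ F y m)) ⟩
    ∑[ m < n ] ∑[ y < n ] ((w y ∧ F y m) ∧ adj G m j)
      ≡⟨ ∑-comm (λ m y → (w y ∧ F y m) ∧ adj G m j) ⟩
    ∑[ y < n ] ∑[ m < n ] ((w y ∧ F y m) ∧ adj G m j)
      ≡⟨ sum-cong-≗ (λ y → sum-cong-≗ (λ m → ∧-assoc (w y) (F y m) (adj G m j))) ⟩
    ∑[ y < n ] ∑[ m < n ] (w y ∧ (F y m ∧ adj G m j))
      ≡⟨ sum-cong-≗ (λ y → *-distribˡ-sum (w y) (λ m → F y m ∧ adj G m j)) ⟨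
    ∑[ y < n ] (w y ∧ ∑v G (F y) j)
      ∎
    where open ≡-Reasoning

  lookup-vG : ∀ i j → lookup (vG G i) j ≡ adj G i j
  lookup-vG i j = begin
    lookup (vG G i) j
      ≡⟨ lookup-sumOver (tabulate (adj G i)) e j ⟩
    ∑[ a < n ] (lookup (tabulate (adj G i)) a ∧ lookup (e a) j)
      ≡⟨ sum-cong-≗ (λ a → cong₂ _∧_ (lookup∘tabulate _ a) (lookup∘tabulate (δ a) j)) ⟩
    ∑[ a < n ] (adj G i a ∧ δ a j)
      ≡⟨ ∑-δ (adj G i) j ⟩
    adj G i j
      ∎
    where open ≡-Reasoning

  lookup-sumOver-vG : ∀ (D : Subset n) j → lookup (sumOver D (vG G)) j ≡ ∑v G (lookup D) j
  lookup-sumOver-vG D j =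
    trans (lookup-sumOver D (vG G) j) (sum-cong-≗ (λ i → cong (lookup D i ∧_) (lookup-vG i j)))

  lookup-sumOver-row : ∀ (C D : Subset n) j →
    lookup (sumOver D (row G C)) j ≡ ∑v G (lookup D) j ∧ lookup C j
  lookup-sumOver-row C D j = begin
    lookup (sumOver D (row G C)) j
      ≡⟨ lookup-sumOver D (row G C) j ⟩
    ∑[ i < n ] (lookup D i ∧ lookup (row G C i) j)
      ≡⟨ sum-cong-≗ (λ i → cong (lookup D i ∧_) (lookup∘tabulate _ j)) ⟩
    ∑[ i < n ] (lookup D i ∧ (adj G i j ∧ lookup C j))
      ≡⟨ sum-cong-≗ (λ i → ∧-assoc (lookup D i) (adj G i j) (lookup C j)) ⟨
    ∑[ i < n ] ((lookup D i ∧ adj G i j) ∧ lookup C j)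
      ≡⟨ *-distribʳ-sum (lookup C j) (λ i → lookup D i ∧ adj G i j) ⟨
    ∑v G (lookup D) j ∧ lookup C j
      ∎
    where open ≡-Reasoning

  -- x ∈ ⟨I_X ∪ A_X⟩ iff off X it agrees with some Σ_{i ∈ d} v_i, d ⊆ X: the I_X part is free inside X.
  Span-IA′ : Vector Bool n → 𝔽₂^ n → Set
  Span-IA′ X x = ∃ λ d → d ⊑ X × (∀ j → X j ≡ false → lookup x j ≡ ∑v G d j)

  Span-IA⇒Span-IA′ : ∀ {X : Subset n} {x} → Span-IA G X x → Span-IA′ (lookup X) x
  Span-IA⇒Span-IA′ (D , D′ , D⊆X , D′⊆X , refl) = lookup D′ , ⊆⇒⊑ D′⊆X , λ j Xj →
    trans (lookup-zipWith _xor_ j (sumOver D e) (sumOver D′ (vG G)))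
          (cong₂ _xor_ (trans (lookup-sumOver-e D j) (⊑-false (⊆⇒⊑ D⊆X) j Xj)) (lookup-sumOver-vG D′ j))

  Span-IA′⇒Span-IA : ∀ {X : Subset n} {x} → Span-IA′ (lookup X) x → Span-IA G X x
  Span-IA′⇒Span-IA {X} {x} (d , d⊑X , x≡∑v) =
    D , tabulate d , (λ {j} → ⊑⇒⊆ D⊑X) , (λ {j} → ⊑⇒⊆ (λ i p → d⊑X i (trans (sym (lookup∘tabulate d i)) p))) ,
    vec-ext (λ j → sym (D+∑v≡x j))
    where
    D : Subset n
    D = tabulate (λ j → lookup x j xor ∑v G d j)
    D⊑X : lookup D ⊑ lookup X
    D⊑X = ⊑-intro (λ j Xj → trans (lookup∘tabulate _ j)
                                  (trans (cong (_xor ∑v G d j) (x≡∑v j Xj)) (xor-same (∑v G d j))))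
    D+∑v≡x : ∀ j → lookup (sumOver D e +ᵥ sumOver (tabulate d) (vG G)) j ≡ lookup x j
    D+∑v≡x j = begin
      lookup (sumOver D e +ᵥ sumOver (tabulate d) (vG G)) j
        ≡⟨ lookup-zipWith _xor_ j (sumOver D e) _ ⟩
      lookup (sumOver D e) j xor lookup (sumOver (tabulate d) (vG G)) j
        ≡⟨ cong₂ _xor_ (trans (lookup-sumOver-e D j) (lookup∘tabulate _ j))
                       (trans (lookup-sumOver-vG (tabulate d) j) (∑v-cong (lookup∘tabulate d) j)) ⟩
      (lookup x j xor ∑v G d j) xor ∑v G d j
        ≡⟨ xor-cancelʳ (lookup x j) (∑v G d j) ⟩
      lookup x j
        ∎
      where open ≡-Reasoning

  Span-IA′-sub : ∀ {X : Vector Bool n} {x y} → Span-IA′ X x → Span-IA′ X y → Span-IA′ X (x -ᵥ y)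
  Span-IA′-sub {x = x} {y} (dx , dx⊑X , x≡) (dy , dy⊑X , y≡) =
    (λ a → dx a xor dy a) , ⊑-xor dx⊑X dy⊑X ,
    λ j Xj → trans (lookup-diff x y j) (trans (cong₂ _xor_ (x≡ j Xj) (y≡ j Xj)) (sym (∑v-xor dx dy j)))

  Span-IA-sub : ∀ {X : Subset n} {x y} → Span-IA G X x → Span-IA G X y → Span-IA′ (lookup X) (x -ᵥ y)
  Span-IA-sub {x = x} {y} x∈ y∈ = Span-IA′-sub {x = x} {y} (Span-IA⇒Span-IA′ x∈) (Span-IA⇒Span-IA′ y∈)

  Independent : (C Y : Vector Bool n) → Set
  Independent C Y = ∀ d → d ⊑ Y → ∑v G d ≗ const false on C → ∀ i → d i ≡ false

  RowsIndep⇒Independent : ∀ {C Y : Subset n} → RowsIndep G C Y → Independent (lookup C) (lookup Y)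
  RowsIndep⇒Independent {C} {Y} indep d d⊑Y ∑vd≡0 i =
    trans (sym (lookup∘tabulate d i)) (trans (cong (λ D → lookup D i) D≡⊥) (lookup-⊥ i))
    where
    rowSum≡0 : ∀ j → lookup (sumOver (tabulate d) (row G C)) j ≡ lookup 0ᵥ j
    rowSum≡0 j = trans (lookup-sumOver-row C (tabulate d) j)
      (trans (∧≡false (λ Cj → trans (∑v-cong (lookup∘tabulate d) j) (∑vd≡0 j Cj))) (sym (lookup-replicate j false)))
    D≡⊥ : tabulate d ≡ ⊥
    D≡⊥ = indep (tabulate d) (⊑⇒⊆ (λ a p → d⊑Y a (trans (sym (lookup∘tabulate d a)) p))) (vec-ext rowSum≡0)

  Independent-mono : ∀ {C C′ Y : Vector Bool n} → C′ ⊑ C → Independent C′ Y → Independent C Y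
  Independent-mono C′⊑C indep d d⊑Y ∑vd≡0 = indep d d⊑Y (λ j C′j → ∑vd≡0 j (C′⊑C j C′j))

  Independent-unique : ∀ {C Y c c′ : Vector Bool n} → Independent C Y → c ⊑ Y → c′ ⊑ Y →
    ∑v G c ≗ ∑v G c′ on C → ∀ a → c a ≡ c′ a
  Independent-unique {c = c} {c′} indep c⊑Y c′⊑Y ∑v≡ a =
    xor≡false⇒≡ (indep (λ a → c a xor c′ a) (⊑-xor c⊑Y c′⊑Y)
      (λ j Cj → trans (∑v-xor c c′ j) (trans (cong (_xor ∑v G c′ j) (∑v≡ j Cj)) (xor-same (∑v G c′ j)))) a)

  Independent-witness : ∀ {C Y d : Vector Bool n} {q} → Independent C Y → d ⊑ Y → d q ≡ true →
    ∃ λ l → C l ≡ true × ∑v G d l ≡ true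
  Independent-witness {C} {Y} {d} {q} indep d⊑Y dq
    with any? (λ l → (C l ≟ᵇ true) ×-dec (∑v G d l ≟ᵇ true))
  ... | yes found = found
  ... | no none   =
    contradiction (trans (sym dq) (indep d d⊑Y (λ l Cl → ¬-not (λ ∑vdl≡1 → none (l , Cl , ∑vdl≡1))) q)) λ ()

  -- Independent rows have full rank

  Solvable : (C Q : Vector Bool n) → Set
  Solvable C Q = ∀ t → ∃ λ g → g ⊑ C × ∑v G g ≗ t on Q

  Solvable-mono : ∀ {C Q Q′ : Vector Bool n} → Q′ ⊑ Q → Solvable C Q → Solvable C Q′
  Solvable-mono Q′⊑Q solve t with solve t
  ... | g , g⊑C , ∑vg≗t = g , g⊑C , λ y Q′y → ∑vg≗t y (Q′⊑Q y Q′y)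

  -- With F a dual basis of Q, h = e_l + Σ_{y₀ ∈ Q} adj(y₀, l) F y₀ vanishes on Q, and its value at q is
  -- the l-coordinate of the nonzero dependency dep ⊆ Y; independence yields an l ∈ C where it is 1.
  separating-vector : ∀ {C Y Q : Vector Bool n} {q} → Independent C Y → Q ⊑ Y → Y q ≡ true →
    Q q ≡ false → Solvable C Q → ∃ λ h → h ⊑ C × ∑v G h ≗ const false on Q × ∑v G h q ≡ true
  separating-vector {C} {Y} {Q} {q} indep Q⊑Y Yq Qq solve = h , h⊑C , ∑vh≡0 , ∑vh≡1
    where
    F : Fin n → Vector Bool n
    F y₀ = proj₁ (solve (δ y₀))
    F⊑C : ∀ y₀ → F y₀ ⊑ C
    F⊑C y₀ = proj₁ (proj₂ (solve (δ y₀)))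
    ∑vF≗δ : ∀ y₀ → ∑v G (F y₀) ≗ δ y₀ on Q
    ∑vF≗δ y₀ = proj₂ (proj₂ (solve (δ y₀)))
    coeff : Vector Bool n
    coeff a = Q a ∧ ∑v G (F a) q
    dep : Vector Bool n
    dep a = coeff a xor δ q a
    dep⊑Y : dep ⊑ Y
    dep⊑Y = ⊑-xor (λ a p → Q⊑Y a (proj₁ (∧≡true⇒ p))) (δ⊑ Yq)
    witness : ∃ λ l → C l ≡ true × ∑v G dep l ≡ true
    witness = Independent-witness indep dep⊑Y (cong₂ _xor_ (cong (_∧ ∑v G (F q) q) Qq) (δ-diag q))
    l : Fin n
    l = proj₁ witness
    w : Vector Bool n
    w y₀ = Q y₀ ∧ adj G y₀ l
    h : Vector Bool n
    h m = δ l m xor ∑[ y₀ < n ] (w y₀ ∧ F y₀ m)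
    h⊑C : h ⊑ C
    h⊑C = ⊑-xor (δ⊑ (proj₁ (proj₂ witness))) (⊑-∑ w F⊑C)
    ∑vh : ∀ y → ∑v G h y ≡ adj G l y xor ∑[ y₀ < n ] (w y₀ ∧ ∑v G (F y₀) y)
    ∑vh y = trans (∑v-xor (δ l) _ y) (cong₂ _xor_ (∑v-δ l y) (∑v-∑ w F y))
    ∑vh≡0 : ∑v G h ≗ const false on Q
    ∑vh≡0 y Qy = begin
      ∑v G h y
        ≡⟨ ∑vh y ⟩
      adj G l y xor ∑[ y₀ < n ] (w y₀ ∧ ∑v G (F y₀) y)
        ≡⟨ cong (adj G l y xor_) (sum-cong-≗ (λ y₀ → cong (w y₀ ∧_) (∑vF≗δ y₀ y Qy))) ⟩
      adj G l y xor ∑[ y₀ < n ] (w y₀ ∧ δ y₀ y)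
        ≡⟨ cong (adj G l y xor_) (∑-δ w y) ⟩
      adj G l y xor (Q y ∧ adj G y l)
        ≡⟨ cong (λ b → adj G l y xor (b ∧ adj G y l)) Qy ⟩
      adj G l y xor adj G y l
        ≡⟨ cong (adj G l y xor_) (Graph.sym G y l) ⟩
      adj G l y xor adj G l y
        ≡⟨ xor-same (adj G l y) ⟩
      false
        ∎
      where open ≡-Reasoning
    ∑vh≡1 : ∑v G h q ≡ true
    ∑vh≡1 = begin
      ∑v G h q
        ≡⟨ ∑vh q ⟩
      adj G l q xor ∑[ y₀ < n ] (w y₀ ∧ ∑v G (F y₀) q)
        ≡⟨ xor-comm (adj G l q) _ ⟩
      ∑[ y₀ < n ] (w y₀ ∧ ∑v G (F y₀) q) xor adj G l q
        ≡⟨ cong₂ _xor_ (sum-cong-≗ (λ a → ∧-swapʳ (Q a) (adj G a l) _)) (Graph.sym G l q) ⟩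
      ∑v G coeff l xor adj G q l
        ≡⟨ cong (∑v G coeff l xor_) (∑v-δ q l) ⟨
      ∑v G coeff l xor ∑v G (δ q) l
        ≡⟨ ∑v-xor coeff (δ q) l ⟨
      ∑v G dep l
        ≡⟨ proj₂ (proj₂ witness) ⟩
      true
        ∎
      where open ≡-Reasoning

  Solvable-insert : ∀ {C Y Q : Vector Bool n} {q} → Independent C Y → Q ⊑ Y → Y q ≡ true →
    Solvable C Q → Solvable C (λ y → Q y ∨ δ q y)
  Solvable-insert {C} {Q = Q} {q} indep Q⊑Y Yq solve with Q q in Qq
  ... | true  = Solvable-mono (λ y p → [ id , (λ δqy → subst (λ z → Q z ≡ true) (sym (δ⇒≡ δqy)) Qq) ]′
                                          (∨≡true⇒ p)) solve
  ... | false = λ t → adjust t (solve t) (separating-vector indep Q⊑Y Yq Qq solve)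
    where
    adjust : ∀ t → ∃ (λ g → g ⊑ C × ∑v G g ≗ t on Q) →
      ∃ (λ h → h ⊑ C × ∑v G h ≗ const false on Q × ∑v G h q ≡ true) →
      ∃ λ g → g ⊑ C × ∑v G g ≗ t on (λ y → Q y ∨ δ q y)
    adjust t (g₀ , g₀⊑C , ∑vg₀≗t) (h , h⊑C , ∑vh≡0 , ∑vh≡1) = g , ⊑-xor g₀⊑C (⊑-∧ˡ s h⊑C) , ∑vg≗t
      where
      s : Bool
      s = t q xor ∑v G g₀ q
      g : Vector Bool n
      g m = g₀ m xor (s ∧ h m)
      ∑vg : ∀ y → ∑v G g y ≡ ∑v G g₀ y xor (s ∧ ∑v G h y)
      ∑vg y = trans (∑v-xor g₀ _ y) (cong (∑v G g₀ y xor_) (∑v-scale s h y))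
      ∑vg≗t : ∑v G g ≗ t on (λ y → Q y ∨ δ q y)
      ∑vg≗t y p with ∨≡true⇒ p
      ... | inj₁ Qy  = trans (∑vg y) (trans (cong₂ (λ a b → a xor (s ∧ b)) (∑vg₀≗t y Qy) (∑vh≡0 y Qy))
                                            (trans (cong (t y xor_) (∧-zeroʳ s)) (xor-identityʳ (t y))))
      ... | inj₂ δqy = subst (λ z → ∑v G g z ≡ t z) (sym (δ⇒≡ δqy)) (begin
        ∑v G g q                       ≡⟨ ∑vg q ⟩
        ∑v G g₀ q xor (s ∧ ∑v G h q)   ≡⟨ cong (λ b → ∑v G g₀ q xor (s ∧ b)) ∑vh≡1 ⟩
        ∑v G g₀ q xor (s ∧ true)       ≡⟨ cong (∑v G g₀ q xor_) (∧-identityʳ s) ⟩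
        ∑v G g₀ q xor s                ≡⟨ xor-cancelˡ (∑v G g₀ q) (t q) ⟩
        t q                            ∎)
        where open ≡-Reasoning

  Solvable-covering : ∀ {C Y : Vector Bool n} → Independent C Y → ∀ (L : List (Fin n)) →
    ∃ λ Q → Q ⊑ Y × Solvable C Q × (∀ {y} → y ∈ˡ L → Y y ≡ true → Q y ≡ true)
  Solvable-covering indep [] = const false , (λ _ ()) , (λ _ → const false , (λ _ ()) , λ _ ()) , λ ()
  Solvable-covering {Y = Y} indep (q ∷ L) with Solvable-covering indep L | Y q in Yq
  ... | Q , Q⊑Y , solve , covers | false = Q , Q⊑Y , solve , λ
    { (here refl) Yy → contradiction (trans (sym Yy) Yq) λ ()
    ; (there y∈L) Yy → covers y∈L Yy }
  ... | Q , Q⊑Y , solve , covers | true =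
    (λ y → Q y ∨ δ q y) ,
    (λ y p → [ Q⊑Y y , (λ δqy → subst (λ z → Y z ≡ true) (sym (δ⇒≡ δqy)) Yq) ]′ (∨≡true⇒ p)) ,
    Solvable-insert indep Q⊑Y Yq solve ,
    λ { (here refl) _  → trans (cong (Q q ∨_) (δ-diag q)) (∨-zeroʳ (Q q))
      ; (there y∈L) Yy → cong (_∨ _) (covers y∈L Yy) }

  Independent⇒Solvable : ∀ {C Y : Vector Bool n} → Independent C Y → Solvable C Y
  Independent⇒Solvable indep with Solvable-covering indep (allFin n)
  ... | _ , _ , solve , covers = Solvable-mono (λ y → covers (∈-allFin y)) solve

  RowBasis : (R C Y : Vector Bool n) → Set
  RowBasis R C Y = Σ (Fin n → Vector Bool n) λ c →
    (∀ i → c i ⊑ Y) × (∀ i → R i ≡ true → adj G i ≗ ∑v G (c i) on C)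

  RowsIndep-or-dependent : ∀ (C Y : Subset n) → RowsIndep G C Y ⊎
    ∃ λ d → d ⊑ lookup Y × ∑v G d ≗ const false on lookup C × ∃ λ a → d a ≡ true
  RowsIndep-or-dependent C Y
    with anySubset? {P = λ D → D ⊆ Y × sumOver D (row G C) ≡ 0ᵥ × Nonempty D}
                    (λ D → (D ⊆? Y) ×-dec (≡-dec _≟ᵇ_ (sumOver D (row G C)) 0ᵥ) ×-dec nonempty? D)
  ... | yes (D , D⊆Y , rowSum≡0 , a , a∈D) = inj₂ (lookup D , ⊆⇒⊑ D⊆Y , ∑vD≡0 , a , []=⇒lookup a∈D)
    where
    ∑vD≡0 : ∑v G (lookup D) ≗ const false on lookup C
    ∑vD≡0 j Cj = begin
      ∑v G (lookup D) j                   ≡⟨ ∧-identityʳ _ ⟨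
      ∑v G (lookup D) j ∧ true            ≡⟨ cong (_ ∧_) Cj ⟨
      ∑v G (lookup D) j ∧ lookup C j      ≡⟨ lookup-sumOver-row C D j ⟨
      lookup (sumOver D (row G C)) j      ≡⟨ cong (λ v → lookup v j) rowSum≡0 ⟩
      lookup 0ᵥ j                         ≡⟨ lookup-replicate j false ⟩
      false                               ∎
      where open ≡-Reasoning
  ... | no none = inj₁ (λ D D⊆Y rowSum≡0 → Empty-unique (λ ne → none (D , D⊆Y , rowSum≡0 , ne)))

  dependency-expresses-row : ∀ {C Y d : Vector Bool n} {i a} → Independent C Y → Y i ≡ false →
    d ⊑ (λ b → Y b ∨ δ i b) → ∑v G d ≗ const false on C → d a ≡ true →
    (λ b → d b xor δ i b) ⊑ Y × adj G i ≗ ∑v G (λ b → d b xor δ i b) on C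
  dependency-expresses-row {C} {Y} {d} {i} {a} indep Yi d⊑Y+i ∑vd≡0 da = c⊑Y , row≗∑vc
    where
    di : d i ≡ true
    di with d i in di
    ... | true  = refl
    ... | false = contradiction (trans (sym da) (indep d d⊑Y ∑vd≡0 a)) λ ()
      where
      d⊑Y : d ⊑ Y
      d⊑Y b db with ∨≡true⇒ (d⊑Y+i b db)
      ... | inj₁ Yb  = Yb
      ... | inj₂ δib = contradiction (trans (sym db) (subst (λ z → d z ≡ false) (sym (δ⇒≡ δib)) di)) λ ()
    c⊑Y : (λ b → d b xor δ i b) ⊑ Y
    c⊑Y b p with d b in db | δ i b in δib
    ... | true  | false = trans (sym (∨-identityʳ (Y b))) (trans (cong (Y b ∨_) (sym δib)) (d⊑Y+i b db))
    ... | false | true  = contradiction (trans (sym di) (subst (λ z → d z ≡ false) (δ⇒≡ δib) db)) λ ()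
    ... | true  | true  = contradiction p λ ()
    ... | false | false = contradiction p λ ()
    row≗∑vc : adj G i ≗ ∑v G (λ b → d b xor δ i b) on C
    row≗∑vc j Cj = sym (trans (∑v-xor d (δ i) j) (cong₂ _xor_ (∑vd≡0 j Cj) (∑v-δ i j)))

  -- Adding a row i ∉ Y to a maximum independent Y creates a dependency, which must involve row i.
  row-basis : ∀ {R C Y : Subset n} → Y ⊆ R → Independent (lookup C) (lookup Y) →
    (∀ Y′ → Y′ ⊆ R → RowsIndep G C Y′ → ∣ Y′ ∣ ≤ ∣ Y ∣) → RowBasis (lookup R) (lookup C) (lookup Y)
  row-basis {R} {C} {Y} Y⊆R indep maximal =
    (λ i → proj₁ (coeffs i)) , (λ i → proj₁ (proj₂ (coeffs i))) , (λ i → proj₂ (proj₂ (coeffs i)))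
    where
    lookup-Y+i : ∀ i b → lookup (Y ∪ ⁅ i ⁆) b ≡ lookup Y b ∨ δ i b
    lookup-Y+i i b = lookup-zipWith _∨_ b Y ⁅ i ⁆
    coeffs : ∀ i → Σ (Vector Bool n) λ c → c ⊑ lookup Y × (lookup R i ≡ true → adj G i ≗ ∑v G c on lookup C)
    coeffs i with lookup Y i in Yi | lookup R i in Ri
    ... | true  | _     = δ i , δ⊑ Yi , λ _ j _ → sym (∑v-δ i j)
    ... | false | false = const false , (λ _ ()) , λ ()
    ... | false | true  with RowsIndep-or-dependent C (Y ∪ ⁅ i ⁆)
    ...   | inj₁ indep′ = contradiction (maximal (Y ∪ ⁅ i ⁆) Y+i⊆R indep′) (<⇒≱ ∣Y∣<∣Y+i∣)
      where
      Y+i⊆R : Y ∪ ⁅ i ⁆ ⊆ R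
      Y+i⊆R = ⊑⇒⊆ (λ b p → [ ⊆⇒⊑ Y⊆R b , (λ δib → subst (λ z → lookup R z ≡ true) (sym (δ⇒≡ δib)) Ri) ]′
                              (∨≡true⇒ (trans (sym (lookup-Y+i i b)) p)))
      ∣Y∣<∣Y+i∣ : ∣ Y ∣ < ∣ Y ∪ ⁅ i ⁆ ∣
      ∣Y∣<∣Y+i∣ = p⊂q⇒∣p∣<∣q∣ (p⊆p∪q ⁅ i ⁆ , i , q⊆p∪q Y ⁅ i ⁆ (x∈⁅x⁆ i) ,
                                λ i∈Y → contradiction (trans (sym ([]=⇒lookup i∈Y)) Yi) λ ())
    ...   | inj₂ (d , d⊑Y+i , ∑vd≡0 , a , da) =
      let c⊑Y , row≗∑vc = dependency-expresses-row indep Yi (λ b p → trans (sym (lookup-Y+i i b)) (d⊑Y+i b p))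
                                                    ∑vd≡0 da
      in _ , c⊑Y , λ _ → row≗∑vc

  RowBasis-reduce : ∀ {R C Y : Vector Bool n} → RowBasis R C Y → ∀ {d} → d ⊑ R →
    ∃ λ e → e ⊑ Y × ∑v G d ≗ ∑v G e on C
  RowBasis-reduce (c , c⊑Y , rows) {d} d⊑R = (λ a → ∑[ i < n ] (d i ∧ c i a)) , ⊑-∑ d c⊑Y , λ j Cj →
    trans (sum-cong-≗ (λ i → ∧-cong-if (λ di → rows i (d⊑R i di) j Cj))) (sym (∑v-∑ d c j))

  -- ∑v G f j pairs f with column j, which by symmetry is row j, and the basis expands that row.
  RowBasis-reconstruct : ∀ {R C Y : Vector Bool n} ((c , _) : RowBasis R C Y) → ∀ {f} → f ⊑ C →
    ∀ j → R j ≡ true → ∑v G f j ≡ ∑[ y < n ] (c j y ∧ ∑v G f y)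
  RowBasis-reconstruct (c , _ , rows) {f} f⊑C j Rj = begin
    ∑[ l < n ] (f l ∧ adj G l j)
      ≡⟨ sum-cong-≗ (λ l → ∧-cong-if (λ fl → trans (Graph.sym G l j) (rows j Rj l (f⊑C l fl)))) ⟩
    ∑[ l < n ] (f l ∧ ∑v G (c j) l)
      ≡⟨ sum-cong-≗ (λ l → *-distribˡ-sum (f l) (λ y → c j y ∧ adj G y l)) ⟩
    ∑[ l < n ] ∑[ y < n ] (f l ∧ (c j y ∧ adj G y l))
      ≡⟨ ∑-comm (λ l y → f l ∧ (c j y ∧ adj G y l)) ⟩
    ∑[ y < n ] ∑[ l < n ] (f l ∧ (c j y ∧ adj G y l))
      ≡⟨ sum-cong-≗ (λ y → sum-cong-≗ (λ l →
           trans (∧-swapˡ (f l) (c j y) _) (cong (λ b → c j y ∧ (f l ∧ b)) (Graph.sym G y l)))) ⟩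
    ∑[ y < n ] ∑[ l < n ] (c j y ∧ (f l ∧ adj G l y))
      ≡⟨ sum-cong-≗ (λ y → *-distribˡ-sum (c j y) (λ l → f l ∧ adj G l y)) ⟨
    ∑[ y < n ] (c j y ∧ ∑v G f y)
      ∎
    where open ≡-Reasoning

-- Cuts of bounded rank

-- Y ⊆ Z is a set of rows independent on the columns T ⊆ V − Z with ρ_G(Z) ≤ |Y|,
-- so Y is a row basis of the Z × (V − Z) adjacency matrix.
module Cut (G : Graph n) {T Y Z : Subset n} (Y⊆Z : Y ⊆ Z) (T⊆∁Z : T ⊆ ∁ Z)
           (indepT : Independent G (lookup T) (lookup Y))
           (maximal : ∀ Y′ → Y′ ⊆ Z → RowsIndep G (∁ Z) Y′ → ∣ Y′ ∣ ≤ ∣ Y ∣) where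

  basis : RowBasis G (lookup Z) (lookup (∁ Z)) (lookup Y)
  basis = row-basis G {C = ∁ Z} Y⊆Z (Independent-mono G (⊆⇒⊑ T⊆∁Z) indepT) maximal

  c : Fin n → Vector Bool n
  c = proj₁ basis

  c⊑Y : ∀ j → c j ⊑ lookup Y
  c⊑Y = proj₁ (proj₂ basis)

  rows : ∀ i → lookup Z i ≡ true → adj G i ≗ ∑v G (c i) on lookup (∁ Z)
  rows = proj₂ (proj₂ basis)

  reduce : ∀ {x} → Span-IA′ G (lookup Z) x →
    ∃ λ r → r ⊑ lookup Y × (∀ j → lookup Z j ≡ false → lookup x j ≡ ∑v G r j)
  reduce (d , d⊑Z , x≡∑vd) with RowBasis-reduce G basis {d} d⊑Z
  ... | r , r⊑Y , ∑vd≗∑vr = r , r⊑Y , λ j Zj → trans (x≡∑vd j Zj) (∑vd≗∑vr j (lookup-∁ Z Zj))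

  reconstruct : ∀ {x} → Span-IA′ G (lookup (∁ Z)) x →
    ∀ j → lookup Z j ≡ true → lookup x j ≡ ∑[ y < n ] (c j y ∧ lookup x y)
  reconstruct {x} (f , f⊑∁Z , x≡∑vf) j Zj = begin
    lookup x j                        ≡⟨ x≡∑vf j (lookup-∁ Z Zj) ⟩
    ∑v G f j                          ≡⟨ RowBasis-reconstruct G basis f⊑∁Z j Zj ⟩
    ∑[ y < n ] (c j y ∧ ∑v G f y)     ≡⟨ sum-cong-≗ (λ y → ∧-cong-if (λ cjy → x≡∑vf-on-Y y (c⊑Y j y cjy))) ⟨
    ∑[ y < n ] (c j y ∧ lookup x y)   ∎
    where
    open ≡-Reasoning
    x≡∑vf-on-Y : ∀ y → lookup Y y ≡ true → lookup x y ≡ ∑v G f y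
    x≡∑vf-on-Y y Yy = x≡∑vf y (lookup-∁ Z (⊆⇒⊑ Y⊆Z y Yy))

  diff⊆Z : ∀ {x y} → Span-IA G Z x → Span-IA G Z y → x -ᵥ y ⊆ ∁ T → x -ᵥ y ⊆ Z
  diff⊆Z {x} {y} x∈ y∈ w⊆∁T with reduce {x -ᵥ y} (Span-IA-sub G {x = x} {y} x∈ y∈)
  ... | r , r⊑Y , w≡∑vr = ⊑⇒⊆ {X = x -ᵥ y} (⊑-intro (λ j Zj → trans (w≡∑vr j Zj) (∑v-zero G r≡0 j)))
    where
    w≡0-on-T : ∀ t → lookup T t ≡ true → lookup (x -ᵥ y) t ≡ false
    w≡0-on-T t Tt = ⊑-false (⊆⇒⊑ w⊆∁T) t (lookup-∁ T Tt)
    r≡0 : ∀ a → r a ≡ false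
    r≡0 = indepT r r⊑Y (λ t Tt → trans (sym (w≡∑vr t (lookup-∁⁻ Z (⊆⇒⊑ T⊆∁Z t Tt)))) (w≡0-on-T t Tt))

  diff⊆∁Z : ∀ {x y} → Span-IA G (∁ Z) x → Span-IA G (∁ Z) y → x -ᵥ y ⊆ ∁ Y → x -ᵥ y ⊆ ∁ Z
  diff⊆∁Z {x} {y} x∈ y∈ w⊆∁Y = ⊑⇒⊆ {X = x -ᵥ y} (⊑-intro (λ j ∁Zj →
    trans (reconstruct {x -ᵥ y} (Span-IA-sub G {x = x} {y} x∈ y∈) j (lookup-∁⁻ Z ∁Zj))
          (∑-zero _ (λ a → trans (∧-cong-if (λ cja → w≡0-on-Y a (c⊑Y j a cja))) (∧-zeroʳ (c j a))))))
    where
    w≡0-on-Y : ∀ a → lookup Y a ≡ true → lookup (x -ᵥ y) a ≡ false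
    w≡0-on-Y a Ya = ⊑-false (⊆⇒⊑ w⊆∁Y) a (lookup-∁ Y Ya)

module Transfer (G : Graph n) {T Y Z Z′ : Subset n} (indepT : Independent G (lookup T) (lookup Y))
  (Y⊆Z : Y ⊆ Z) (T⊆∁Z : T ⊆ ∁ Z) (maxZ : ∀ Y′ → Y′ ⊆ Z → RowsIndep G (∁ Z) Y′ → ∣ Y′ ∣ ≤ ∣ Y ∣)
  (Y⊆Z′ : Y ⊆ Z′) (T⊆∁Z′ : T ⊆ ∁ Z′) (maxZ′ : ∀ Y′ → Y′ ⊆ Z′ → RowsIndep G (∁ Z′) Y′ → ∣ Y′ ∣ ≤ ∣ Y ∣) where

  private
    module A = Cut G Y⊆Z T⊆∁Z indepT maxZ
    module B = Cut G Y⊆Z′ T⊆∁Z′ indepT maxZ′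

  coefficients-agree : ∀ {j} → lookup Z j ≡ true → lookup Z′ j ≡ true → ∀ a → A.c j a ≡ B.c j a
  coefficients-agree {j} Zj Z′j = Independent-unique G indepT (A.c⊑Y j) (B.c⊑Y j)
    (λ t Tt → trans (sym (A.rows j Zj t (⊆⇒⊑ T⊆∁Z t Tt))) (B.rows j Z′j t (⊆⇒⊑ T⊆∁Z′ t Tt)))

  -- y is Σ_{i ∈ r} v_i off Z, where r ⊆ Y reduces x off Z′, and Σ_{t ∈ g} v_t on Z, where g ⊆ T
  -- matches x on Y; on Z ∩ Z′ both x and y are then the same combination of their values on Y.
  transfer : ∀ {x} → ∂ G Z′ x → Σ (𝔽₂^ n) λ y → ∂ G Z y × x -ᵥ y ⊆ Z △ Z′
  transfer {x} (x∈Z′ , x∈∁Z′) = y , (Span-IA′⇒Span-IA G y∈Z , Span-IA′⇒Span-IA G y∈∁Z) , x-y⊆Z△Z′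
    where
    reduced : ∃ λ r → r ⊑ lookup Y × (∀ j → lookup Z′ j ≡ false → lookup x j ≡ ∑v G r j)
    reduced = B.reduce {x} (Span-IA⇒Span-IA′ G x∈Z′)
    r : Vector Bool n
    r = proj₁ reduced
    solved : ∃ λ g → g ⊑ lookup T × ∑v G g ≗ lookup x on lookup Y
    solved = Independent⇒Solvable G indepT (lookup x)
    g : Vector Bool n
    g = proj₁ solved
    y : 𝔽₂^ n
    y = tabulate (λ j → if lookup Z j then ∑v G g j else ∑v G r j)
    lookup-y : ∀ {j b} → lookup Z j ≡ b → lookup y j ≡ (if b then ∑v G g j else ∑v G r j)
    lookup-y {j} Zj = trans (lookup∘tabulate _ j) (cong (λ b → if b then ∑v G g j else ∑v G r j) Zj)
    y∈Z : Span-IA′ G (lookup Z) y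
    y∈Z = r , ⊑-trans (proj₁ (proj₂ reduced)) (⊆⇒⊑ Y⊆Z) , λ j Zj → lookup-y Zj
    y∈∁Z : Span-IA′ G (lookup (∁ Z)) y
    y∈∁Z = g , ⊑-trans (proj₁ (proj₂ solved)) (⊆⇒⊑ T⊆∁Z) , λ j ∁Zj → lookup-y (lookup-∁⁻ Z ∁Zj)
    agree-on-Y : ∀ a → lookup Y a ≡ true → lookup x a ≡ lookup y a
    agree-on-Y a Ya = trans (sym (proj₂ (proj₂ solved) a Ya)) (sym (lookup-y (⊆⇒⊑ Y⊆Z a Ya)))
    agree-inside : ∀ {j} → lookup Z j ≡ true → lookup Z′ j ≡ true → lookup x j ≡ lookup y j
    agree-inside {j} Zj Z′j = begin
      lookup x j
        ≡⟨ B.reconstruct {x} (Span-IA⇒Span-IA′ G x∈∁Z′) j Z′j ⟩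
      ∑[ a < n ] (B.c j a ∧ lookup x a)
        ≡⟨ sum-cong-≗ (λ a → cong (_∧ lookup x a) (coefficients-agree Zj Z′j a)) ⟨
      ∑[ a < n ] (A.c j a ∧ lookup x a)
        ≡⟨ sum-cong-≗ (λ a → ∧-cong-if (λ cja → agree-on-Y a (A.c⊑Y j a cja))) ⟩
      ∑[ a < n ] (A.c j a ∧ lookup y a)
        ≡⟨ A.reconstruct {y} y∈∁Z j Zj ⟨
      lookup y j
        ∎
      where open ≡-Reasoning
    agree-outside : ∀ {j} → lookup Z j ≡ false → lookup Z′ j ≡ false → lookup x j ≡ lookup y j
    agree-outside {j} Zj Z′j = trans (proj₂ (proj₂ reduced) j Z′j) (sym (lookup-y Zj))
    x-y⊆Z△Z′ : x -ᵥ y ⊆ Z △ Z′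
    x-y⊆Z△Z′ {j} j∈ with lookup Z j in Zj | lookup Z′ j in Z′j
    ... | true  | true  = contradiction j∈ (≡⇒∉-ᵥ (agree-inside Zj Z′j))
    ... | false | false = contradiction j∈ (≡⇒∉-ᵥ (agree-outside Zj Z′j))
    ... | true  | false = x∈p∪q⁺ (inj₁ (x∈p∧x∉q⇒x∈p─q (lookup⇒[]= j Z Zj) (lookup≡false⇒∉ Z′j)))
    ... | false | true  = x∈p∪q⁺ (inj₂ (x∈p∧x∉q⇒x∈p─q (lookup⇒[]= j Z′ Z′j) (lookup≡false⇒∉ Zj)))

module Boundary (G : Graph n) {S T Y : Subset n} (Y⊆S : Y ⊆ S)
                (indepT : Independent G (lookup T) (lookup Y)) where

  C : Subset n
  C = ∁ (S ∪ T)

  C⊆∁T : C ⊆ ∁ T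
  C⊆∁T = p⊆q⇒∁p⊇∁q (q⊆p∪q S T)

  C⊆∁Y : C ⊆ ∁ Y
  C⊆∁Y = p⊆q⇒∁p⊇∁q (⊆-trans Y⊆S (p⊆p∪q T))

  Admissible : Subset n → Set
  Admissible Z = S ⊆ Z × Z ⊆ ∁ T × (∀ Y′ → Y′ ⊆ Z → RowsIndep G (∁ Z) Y′ → ∣ Y′ ∣ ≤ ∣ Y ∣)

  module CutOf {Z} ((S⊆Z , Z⊆∁T , maxZ) : Admissible Z) =
    Cut G (⊆-trans Y⊆S S⊆Z) (⊆∁-sym Z⊆∁T) indepT maxZ

  module TransferOf {Z Z′} ((S⊆Z , Z⊆∁T , maxZ) : Admissible Z) ((S⊆Z′ , Z′⊆∁T , maxZ′) : Admissible Z′) =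
    Transfer G indepT (⊆-trans Y⊆S S⊆Z) (⊆∁-sym Z⊆∁T) maxZ (⊆-trans Y⊆S S⊆Z′) (⊆∁-sym Z′⊆∁T) maxZ′

  ∈-one-side⇒∈C : ∀ {Z Z′ j} → Admissible Z → Admissible Z′ → j ∈ Z → j ∉ Z′ → j ∈ C
  ∈-one-side⇒∈C (_ , Z⊆∁T , _) (S⊆Z′ , _) j∈Z j∉Z′ =
    x∉p⇒x∈∁p λ j∈S∪T → [ j∉Z′ ∘ S⊆Z′ , x∈∁p⇒x∉p (Z⊆∁T j∈Z) ]′ (x∈p∪q⁻ S T j∈S∪T)

  △⊆C : ∀ {Z Z′} → Admissible Z → Admissible Z′ → Z △ Z′ ⊆ C
  △⊆C {Z} {Z′} adm adm′ j∈ with x∈p∪q⁻ (Z ─ Z′) (Z′ ─ Z) j∈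
  ... | inj₁ j∈Z─Z′ = ∈-one-side⇒∈C adm adm′ (p─q⊆p Z Z′ j∈Z─Z′) (x∈p─q⇒x∉q j∈Z─Z′)
  ... | inj₂ j∈Z′─Z = ∈-one-side⇒∈C adm′ adm (p─q⊆p Z′ Z j∈Z′─Z) (x∈p─q⇒x∉q j∈Z′─Z)

  Span-IA-sub-C⇔C∩Z : ∀ {Z} → Admissible Z → ∀ x y → Span-IA G Z x → Span-IA G Z y →
    Span-I C (x -ᵥ y) ⇔ Span-I (C ∩ Z) (x -ᵥ y)
  Span-IA-sub-C⇔C∩Z adm x y x∈ y∈ = mk⇔
    (λ s → ⊆⇒Span-I (λ j∈ → x∈p∩q⁺ (Span-I⇒⊆ s j∈ ,
                                     CutOf.diff⊆Z adm x∈ y∈ (⊆-trans (Span-I⇒⊆ s) C⊆∁T) j∈)))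
    (λ s → ⊆⇒Span-I (⊆-trans (Span-I⇒⊆ s) (p∩q⊆p C _)))

  Span-IA-sub-C⇔C─Z : ∀ {Z} → Admissible Z → ∀ x y → Span-IA G (∁ Z) x → Span-IA G (∁ Z) y →
    Span-I C (x -ᵥ y) ⇔ Span-I (C ─ Z) (x -ᵥ y)
  Span-IA-sub-C⇔C─Z adm x y x∈ y∈ = mk⇔
    (λ s → ⊆⇒Span-I (λ j∈ → x∈p∧x∉q⇒x∈p─q (Span-I⇒⊆ s j∈)
                              (x∈∁p⇒x∉p (CutOf.diff⊆∁Z adm x∈ y∈ (⊆-trans (Span-I⇒⊆ s) C⊆∁Y) j∈))))
    (λ s → ⊆⇒Span-I (⊆-trans (Span-I⇒⊆ s) (p─q⊆p C _)))

  ∂-sub⊆C⇒≡ : ∀ {Z x y} → Admissible Z → ∂ G Z x → ∂ G Z y → x -ᵥ y ⊆ C → x ≡ y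
  ∂-sub⊆C⇒≡ adm (x∈Z , x∈∁Z) (y∈Z , y∈∁Z) x-y⊆C =
    -ᵥ-⊆∁⇒≡ (CutOf.diff⊆Z adm x∈Z y∈Z (⊆-trans x-y⊆C C⊆∁T))
             (CutOf.diff⊆∁Z adm x∈∁Z y∈∁Z (⊆-trans x-y⊆C C⊆∁Y))

  ∂-sub-C⇔≡ : ∀ {Z} → Admissible Z → ∀ x y → ∂ G Z x → ∂ G Z y → Span-I C (x -ᵥ y) ⇔ x ≡ y
  ∂-sub-C⇔≡ adm x y ∂x ∂y = mk⇔ (∂-sub⊆C⇒≡ adm ∂x ∂y ∘ Span-I⇒⊆) (λ { refl → ⊆⇒Span-I -ᵥ-self })

  ∂-partner : ∀ {Z Z′} → Admissible Z → Admissible Z′ → ∀ x → ∂ G Z′ x →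
    Σ (𝔽₂^ n) λ y →
      (∂ G Z y × Span-I C (x -ᵥ y) × (∀ y′ → ∂ G Z y′ → Span-I C (x -ᵥ y′) → y′ ≡ y))
      × Span-I (C ∩ (Z △ Z′)) (x -ᵥ y)
  ∂-partner adm adm′ x ∂x with TransferOf.transfer adm adm′ ∂x
  ... | y , ∂y , x-y⊆△ =
    y , (∂y , ⊆⇒Span-I x-y⊆C , unique) , ⊆⇒Span-I (λ j∈ → x∈p∩q⁺ (x-y⊆C j∈ , x-y⊆△ j∈))
    where
    x-y⊆C : x -ᵥ y ⊆ C
    x-y⊆C = ⊆-trans x-y⊆△ (△⊆C adm adm′)
    unique : ∀ y′ → ∂ G _ y′ → Span-I C (x -ᵥ y′) → y′ ≡ y
    unique y′ ∂y′ s′ = ∂-sub⊆C⇒≡ adm ∂y′ ∂y (-ᵥ-cancel (Span-I⇒⊆ s′) x-y⊆C)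

proposition6p6 :
  ∀ {n} (G : Graph n) (S T : Subset n) (k : ℕ) →
  S ∩ T ≡ ⊥ →
  ρInduced≡ G S T k →
  (∃ λ X → S ⊆ X × X ⊆ ∁ T × ρ≡ G X k) →
  (∀ X r → S ⊆ X → X ⊆ ∁ T → ρ≡ G X r → k ≤ r) →
  let C = ∁ (S ∪ T) in
  ∀ Z → S ⊆ Z → Z ⊆ ∁ T → ρ≡ G Z k →
    (∀ x y → Span-IA G Z x → Span-IA G Z y →
      (Span-I C (x -ᵥ y) ⇔ Span-I (C ∩ Z) (x -ᵥ y)))
  × (∀ x y → Span-IA G (∁ Z) x → Span-IA G (∁ Z) y →
      (Span-I C (x -ᵥ y) ⇔ Span-I (C ─ Z) (x -ᵥ y)))
  × (∀ x y → ∂ G Z x → ∂ G Z y → (Span-I C (x -ᵥ y) ⇔ x ≡ y))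
  × (∀ Z' → S ⊆ Z' → Z' ⊆ ∁ T → ρ≡ G Z' k →
      ∀ x → ∂ G Z' x →
        Σ (𝔽₂^ n) λ y →
          (∂ G Z y × Span-I C (x -ᵥ y) ×
            (∀ y' → ∂ G Z y' → Span-I C (x -ᵥ y') → y' ≡ y))
          × Span-I (C ∩ (Z △ Z')) (x -ᵥ y))
proposition6p6 G S T k _ ((Y , Y⊆S , indepCols , ∣Y∣≡k) , _) _ _ Z S⊆Z Z⊆∁T (_ , ρZ≤k) =
  Span-IA-sub-C⇔C∩Z adm , Span-IA-sub-C⇔C─Z adm , ∂-sub-C⇔≡ adm ,
  λ Z′ S⊆Z′ Z′⊆∁T (_ , ρZ′≤k) → ∂-partner adm (S⊆Z′ , Z′⊆∁T , ≤∣Y∣ ρZ′≤k)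
  where
  open Boundary G {T = T} Y⊆S
    (Independent-mono G (⊆⇒⊑ (p∪q─p⊆q S T)) (RowsIndep⇒Independent G {C = (S ∪ T) ─ S} indepCols))
  ≤∣Y∣ : ∀ {X} → (∀ Y′ → Y′ ⊆ X → RowsIndep G (∁ X) Y′ → ∣ Y′ ∣ ≤ k) →
    ∀ Y′ → Y′ ⊆ X → RowsIndep G (∁ X) Y′ → ∣ Y′ ∣ ≤ ∣ Y ∣
  ≤∣Y∣ ρ≤k Y′ Y′⊆X indep = subst (∣ Y′ ∣ ≤_) (sym ∣Y∣≡k) (ρ≤k Y′ Y′⊆X indep)
  adm : Admissible Z
  adm = S⊆Z , Z⊆∁T , ≤∣Y∣ ρZ≤k
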